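{- Let $\mathbf{s}=(s_k)_{k\ge 0}$ be a sequence of real numbers and let $E\mathbf{s}=(s_1,s_2,s_3,\dots)$. Let $m\ge 0$ be an integer and put $\varepsilon_m=(-1)^{\binom{m+1}{2}}$. Then for the Hankel determinants $D_{p,n}(\mathbf{t})=\det\big(a_{p+i+j}(\mathbf{t})\big)_{i,j=0}^{n-1}$ (defined in the context) we have $$D_{ -m,0}(\mathbf{s})=1,\qquad D_{ -m,n}(\mathbf{s})=0 \text{ for } 0<n\le m,\qquad D_{ -m,n+m+1}(\mathbf{s})=\varepsilon_m\, D_{m,n}(E\mathbf{s}) \text{ for all integers } n\ge 0.$$ Equivalently, the sequence $(D_{ -m,n}(\mathbf{s}))_{n\ge0}$ equals $(u_n)_{n\ge 0}$ where $u_0=1$, $u_n=0$ for $0<n<m+1$, and $u_{m+1+i}=(-1)^{\binom{m+1}{2}}D_{m,i}(E\mathbf{s})$ for $i\ge 0$.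
   Context: For a real sequence $\mathbf{t}=(t_k)_{k\ge0}$ define numbers $a_{n,k}(\mathbf{t})$ for integers $n,k$ by $a_{0,k}(\mathbf{t})=[k=0]$, $a_{n,k}(\mathbf{t})=0$ for $k<0$, and for $n\ge 1$, $k\ge0$: $a_{n,k}(\mathbf{t})=a_{n-1,k-1}(\mathbf{t})+t_k\,a_{n-1,k}(\mathbf{t})+a_{n-1,k+1}(\mathbf{t})$. Further set $a_{n,k}(\mathbf{t})=0$ for $n<0$. Write $a_n(\mathbf{t})=a_{n,0}(\mathbf{t})$ (so $a_0=1$, $a_1=t_0$, $a_2=t_0^2+1$, $a_n=0$ for $n<0$). For an integer $p$ (possibly negative) and $n\ge 0$, $D_{p,n}(\mathbf{t})=\det\big(a_{p+i+j}(\mathbf{t})\big)_{i,j=0}^{n-1}$, with the determinant of the empty ($n=0$) matrix equal to $1$. -}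

module Defs where

open import Level using (_⊔_)
open import Algebra.Bundles using (CommutativeRing)
open import Data.Nat as ℕ using (ℕ; zero; suc)
open import Data.Nat.Combinatorics using (_C_)
open import Data.Integer as ℤ using (ℤ; +_; -[1+_])
open import Data.Fin using (Fin; zero; suc; toℕ; punchIn)

module Hankel {c ℓ} (R : CommutativeRing c ℓ) where
  open CommutativeRing R hiding (zero)

  -- a_{n,k}(t) for n, k ≥ 0 (a_{n,k} = 0 for k < 0 is built in:
  -- the term a_{n-1,k-1} is absent when k = 0).
  ank : (ℕ → Carrier) → ℕ → ℕ → Carrier
  ank t zero    zero    = 1#
  ank t zero    (suc k) = 0#
  ank t (suc n) zero    = t 0 * ank t n 0 + ank t n 1
  ank t (suc n) (suc k) = ank t n k + t (suc k) * ank t n (suc k) + ank t n (suc (suc k))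

  a : (ℕ → Carrier) → ℤ → Carrier
  a t (+ n)      = ank t n 0
  a t -[1+ n ]   = 0#

  sgn : ℕ → Carrier
  sgn zero    = 1#
  sgn (suc k) = - sgn k

  Σ : ∀ n → (Fin n → Carrier) → Carrier
  Σ zero    f = 0#
  Σ (suc n) f = f zero + Σ n (λ j → f (suc j))

  det : ∀ n → (Fin n → Fin n → Carrier) → Carrier
  det zero    M = 1#
  det (suc n) M = Σ (suc n) (λ j → sgn (toℕ j) * M zero j * det n (λ i k → M (suc i) (punchIn j k)))

  D : ℤ → ℕ → (ℕ → Carrier) → Carrier
  D p n t = det n (λ i j → a t (p ℤ.+ + toℕ i ℤ.+ + toℕ j))

  E : (ℕ → Carrier) → (ℕ → Carrier)
  E s k = s (suc k)

  ε : ℕ → Carrier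
  ε m = sgn (suc m C 2)

{-# OPTIONS --safe #-}
-- Let A(x) and B(x) be the generating functions of aₙ(s) and aₙ(Es). Splitting a Motzkin path
-- at its last visit to level 0 gives A = 1 + s₀xA + x²BA, so 1/A has the coefficients
-- 1, −s₀, −b₀, −b₁, … . Adding to each column j of the Hankel matrix (a_{i+j−m}) these
-- coefficients times the earlier columns (a unitriangular operation) turns row i ≤ m into the
-- unit row e_{m−i} and the lower right n×n block into (Σ_{t≤p} a_{p−t} b_{m+q+t})_{p,q}.
-- Expanding along the first m+1 rows gives the sign (−1)^{0+1+⋯+m} = ε_m; after transposing
-- the block, a second unitriangular column operation with the coefficients aₖ reduces it to the
-- Hankel matrix (b_{m+p+q}) of D_{m,n}(Es). For 0 < n ≤ m the first row of D_{−m,n} vanishes.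
module Submission where

open import Algebra.Bundles using (CommutativeRing)
import Algebra.Properties.Ring as RingProperties
open import Data.Empty using (⊥-elim)
open import Data.Fin as Fin using (Fin; toℕ)
import Data.Integer as ℤ
import Data.Integer.Properties as ℤ
open import Data.Nat as ℕ using (ℕ; zero; suc; _∸_; _<_; _≤_; z≤n; s≤s; _≟_; _≤?_)
import Data.Nat.Properties as ℕ
open import Data.Nat.Combinatorics using (_C_; nC1≡n; nCk+nC[k+1]≡[n+1]C[k+1])
open import Data.Product using (_×_; _,_)
open import Function using (_∘_)
open import Data.Sum using (_⊎_; inj₁; inj₂)
open import Relation.Binary.Definitions using (tri<; tri≈; tri>)
open import Relation.Binary.PropositionalEquality as ≡ using (_≡_; _≢_; refl)
open import Relation.Nullary using (yes; no)
open import Defs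

punchIn : ℕ → ℕ → ℕ
punchIn zero    k       = suc k
punchIn (suc j) zero    = zero
punchIn (suc j) (suc k) = suc (punchIn j k)

punchOut : ℕ → ℕ → ℕ
punchOut zero    zero    = zero
punchOut zero    (suc c) = c
punchOut (suc j) zero    = zero
punchOut (suc j) (suc c) = suc (punchOut j c)

toℕ-punchIn : ∀ {n} (j : Fin (suc n)) (k : Fin n) → toℕ (Fin.punchIn j k) ≡ punchIn (toℕ j) (toℕ k)
toℕ-punchIn Fin.zero    k           = refl
toℕ-punchIn (Fin.suc j) Fin.zero    = refl
toℕ-punchIn (Fin.suc j) (Fin.suc k) = ≡.cong suc (toℕ-punchIn j k)

punchInᵢ≢i : ∀ j k → punchIn j k ≢ j
punchInᵢ≢i (suc j) (suc k) eq = punchInᵢ≢i j k (ℕ.suc-injective eq)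

punchIn-injective : ∀ j k k′ → punchIn j k ≡ punchIn j k′ → k ≡ k′
punchIn-injective zero    k       k′       eq = ℕ.suc-injective eq
punchIn-injective (suc j) zero    zero     eq = refl
punchIn-injective (suc j) (suc k) (suc k′) eq = ≡.cong suc (punchIn-injective j k k′ (ℕ.suc-injective eq))

punchIn-punchOut : ∀ {j c} → j ≢ c → punchIn j (punchOut j c) ≡ c
punchIn-punchOut {zero}  {zero}  j≢c = ⊥-elim (j≢c refl)
punchIn-punchOut {zero}  {suc c} j≢c = refl
punchIn-punchOut {suc j} {zero}  j≢c = refl
punchIn-punchOut {suc j} {suc c} j≢c = ≡.cong suc (punchIn-punchOut (j≢c ∘ ≡.cong suc))
  where open import Function using (_∘_)

punchOut-< : ∀ {n j c} → j < suc n → c < suc n → j ≢ c → punchOut j c < n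
punchOut-< {n}     {zero}  {zero}  _         _         j≢c = ⊥-elim (j≢c refl)
punchOut-< {n}     {zero}  {suc c} _         (s≤s c<n) _   = c<n
punchOut-< {zero}  {suc j} {_}     (s≤s ()) _         _
punchOut-< {suc n} {suc j} {zero}  _         _         _   = s≤s z≤n
punchOut-< {suc n} {suc j} {suc c} (s≤s j<) (s≤s c<) j≢c = s≤s (punchOut-< j< c< (j≢c ∘ ≡.cong suc))

punchIn-≤ : ∀ j k → punchIn j k ≤ suc k
punchIn-≤ zero    k       = ℕ.≤-refl
punchIn-≤ (suc j) zero    = z≤n
punchIn-≤ (suc j) (suc k) = s≤s (punchIn-≤ j k)

punchIn-bound : ∀ {n} j {k} → k < n → punchIn j k < suc n
punchIn-bound j {k} k<n = s≤s (ℕ.≤-trans (punchIn-≤ j k) k<n)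

punchOut-suc : ∀ {j c} → j ≢ c → j ≢ suc c → punchOut j (suc c) ≡ suc (punchOut j c)
punchOut-suc {zero}        {zero}  j≢c _ = ⊥-elim (j≢c refl)
punchOut-suc {zero}        {suc c} _   _ = refl
punchOut-suc {suc zero}    {zero}  _   j≢1+c = ⊥-elim (j≢1+c refl)
punchOut-suc {suc (suc j)} {zero}  _   _ = refl
punchOut-suc {suc j}       {suc c} j≢c j≢1+c =
  ≡.cong suc (punchOut-suc (j≢c ∘ ≡.cong suc) (j≢1+c ∘ ≡.cong suc))

punchIn-adjacent : ∀ c k → punchIn c k ≡ punchIn (suc c) k ⊎ (punchIn c k ≡ suc c × punchIn (suc c) k ≡ c)
punchIn-adjacent zero    zero    = inj₂ (refl , refl)
punchIn-adjacent zero    (suc k) = inj₁ refl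
punchIn-adjacent (suc c) zero    = inj₁ refl
punchIn-adjacent (suc c) (suc k) with punchIn-adjacent c k
... | inj₁ eq         = inj₁ (≡.cong suc eq)
... | inj₂ (eq , eq′) = inj₂ (≡.cong suc eq , ≡.cong suc eq′)

punchIn-below : ∀ {j k} → k < j → punchIn j k ≡ k
punchIn-below {suc j} {zero}  _         = refl
punchIn-below {suc j} {suc k} (s≤s k<j) = ≡.cong suc (punchIn-below k<j)

punchIn-above : ∀ {j k} → j ≤ k → punchIn j k ≡ suc k
punchIn-above {zero}  {k}     _         = refl
punchIn-above {suc j} {suc k} (s≤s j≤k) = ≡.cong suc (punchIn-above j≤k)

module FiniteSums {c ℓ} (R : CommutativeRing c ℓ) where
  open CommutativeRing R hiding (zero) renaming (refl to ≈-refl; sym to ≈-sym; trans to ≈-trans)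
  open RingProperties ring using (-‿+-comm; -0#≈0#)
  open import Algebra.Solver.Ring.NaturalCoefficients.Default commutativeSemiring using (solve; _:+_; _:*_; _:=_)
  open import Relation.Binary.Reasoning.Setoid setoid

  ∑ : ℕ → (ℕ → Carrier) → Carrier
  ∑ zero    f = 0#
  ∑ (suc n) f = f 0 + ∑ n (λ j → f (suc j))

  ∑-cong : ∀ n {f g} → (∀ j → j < n → f j ≈ g j) → ∑ n f ≈ ∑ n g
  ∑-cong zero    f≈g = ≈-refl
  ∑-cong (suc n) f≈g = +-cong (f≈g 0 (s≤s z≤n)) (∑-cong n (λ j j<n → f≈g (suc j) (s≤s j<n)))

  ∑-zero : ∀ n {f} → (∀ j → j < n → f j ≈ 0#) → ∑ n f ≈ 0#
  ∑-zero zero    f≈0 = ≈-refl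
  ∑-zero (suc n) f≈0 = ≈-trans (+-cong (f≈0 0 (s≤s z≤n)) (∑-zero n (λ j j<n → f≈0 (suc j) (s≤s j<n)))) (+-identityˡ 0#)

  ∑-distrib-+ : ∀ n f g → ∑ n (λ j → f j + g j) ≈ ∑ n f + ∑ n g
  ∑-distrib-+ zero    f g = ≈-sym (+-identityˡ 0#)
  ∑-distrib-+ (suc n) f g = ≈-trans (+-congˡ (∑-distrib-+ n _ _)) (+-middle _ _ _ _)
    where
    +-middle : ∀ x y z w → (x + y) + (z + w) ≈ (x + z) + (y + w)
    +-middle = solve 4 (λ x y z w → (x :+ y) :+ (z :+ w) := (x :+ z) :+ (y :+ w)) ≈-refl

  ∑-distribˡ : ∀ n x f → ∑ n (λ j → x * f j) ≈ x * ∑ n f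
  ∑-distribˡ zero    x f = ≈-sym (zeroʳ x)
  ∑-distribˡ (suc n) x f = ≈-trans (+-congˡ (∑-distribˡ n x _)) (≈-sym (distribˡ x _ _))

  ∑-linear : ∀ n x (f g w : ℕ → Carrier) → ∑ n (λ j → (x * f j + g j) * w j) ≈ x * ∑ n (λ j → f j * w j) + ∑ n (λ j → g j * w j)
  ∑-linear n x f g w = begin
    ∑ n (λ j → (x * f j + g j) * w j)                        ≈⟨ ∑-cong n (λ j _ → expand x (f j) (g j) (w j)) ⟩
    ∑ n (λ j → x * (f j * w j) + g j * w j)                  ≈⟨ ∑-distrib-+ n (λ j → x * (f j * w j)) (λ j → g j * w j) ⟩
    ∑ n (λ j → x * (f j * w j)) + ∑ n (λ j → g j * w j)      ≈⟨ +-congʳ (∑-distribˡ n x (λ j → f j * w j)) ⟩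
    x * ∑ n (λ j → f j * w j) + ∑ n (λ j → g j * w j)        ∎
    where
    expand : ∀ x f g w → (x * f + g) * w ≈ x * (f * w) + g * w
    expand = solve 4 (λ x f g w → (x :* f :+ g) :* w := x :* (f :* w) :+ g :* w) ≈-refl

  ∑-neg : ∀ n f → ∑ n (λ j → - f j) ≈ - ∑ n f
  ∑-neg zero    f = ≈-sym -0#≈0#
  ∑-neg (suc n) f = ≈-trans (+-congˡ (∑-neg n _)) (-‿+-comm _ _)

  ∑-last : ∀ n f → ∑ (suc n) f ≈ ∑ n f + f n
  ∑-last zero    f = +-comm _ _
  ∑-last (suc n) f = ≈-trans (+-congˡ (∑-last n _)) (≈-sym (+-assoc _ _ _))

  ∑-reverse : ∀ n f → ∑ n f ≈ ∑ n (λ j → f (n ∸ suc j))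
  ∑-reverse zero    f = ≈-refl
  ∑-reverse (suc n) f = begin
    f 0 + ∑ n (λ j → f (suc j))              ≈⟨ +-congˡ (∑-reverse n _) ⟩
    f 0 + ∑ n (λ j → f (suc (n ∸ suc j)))    ≈⟨ +-comm _ _ ⟩
    ∑ n (λ j → f (suc (n ∸ suc j))) + f 0    ≈⟨ +-cong (∑-cong n (λ j j<n → reflexive (≡.cong f (≡.sym (ℕ.+-∸-assoc 1 j<n)))))
                                                        (reflexive (≡.cong f (≡.sym (ℕ.n∸n≡0 n)))) ⟩
    ∑ n (λ j → f (n ∸ j)) + f (n ∸ n)        ≈⟨ ∑-last n (λ j → f (n ∸ j)) ⟨
    ∑ (suc n) (λ j → f (n ∸ j))              ∎

  ∑-adjacent-cancel : ∀ n c f → suc c < n → (∀ j → j < n → j ≢ c → j ≢ suc c → f j ≈ 0#)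
    → f c + f (suc c) ≈ 0# → ∑ n f ≈ 0#
  ∑-adjacent-cancel (suc (suc n)) zero f _ others pair = begin
    f 0 + (f 1 + ∑ n (λ j → f (suc (suc j))))   ≈⟨ +-assoc _ _ _ ⟨
    (f 0 + f 1) + ∑ n (λ j → f (suc (suc j)))   ≈⟨ +-cong pair (∑-zero n (λ j j<n → others (suc (suc j)) (s≤s (s≤s j<n)) (λ ()) (λ ()))) ⟩
    0# + 0#                                     ≈⟨ +-identityˡ 0# ⟩
    0#                                          ∎
  ∑-adjacent-cancel (suc n) (suc c) f (s≤s 1+c<n) others pair =
    ≈-trans (+-cong (others 0 (s≤s z≤n) (λ ()) (λ ()))
                    (∑-adjacent-cancel n c _ 1+c<n
                       (λ j j<n j≢c j≢1+c → others (suc j) (s≤s j<n) (j≢c ∘ ℕ.suc-injective) (j≢1+c ∘ ℕ.suc-injective))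
                       pair))
            (+-identityˡ 0#)

  δ : ℕ → ℕ → Carrier
  δ zero    zero    = 1#
  δ zero    (suc _) = 0#
  δ (suc _) zero    = 0#
  δ (suc i) (suc j) = δ i j

  δ-sym : ∀ i j → δ i j ≡ δ j i
  δ-sym zero    zero    = refl
  δ-sym zero    (suc j) = refl
  δ-sym (suc i) zero    = refl
  δ-sym (suc i) (suc j) = δ-sym i j

  δ-≢ : ∀ {i j} → i ≢ j → δ i j ≡ 0#
  δ-≢ {zero}  {zero}  i≢j = ⊥-elim (i≢j refl)
  δ-≢ {zero}  {suc j} _   = refl
  δ-≢ {suc i} {zero}  _   = refl
  δ-≢ {suc i} {suc j} i≢j = δ-≢ (i≢j ∘ ≡.cong suc)

  δ-+ : ∀ k i j → δ (k ℕ.+ i) (k ℕ.+ j) ≡ δ i j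
  δ-+ zero    i j = refl
  δ-+ (suc k) i j = δ-+ k i j

  ∑-δ : ∀ n {k} g → k < n → ∑ n (λ j → δ j k * g j) ≈ g k
  ∑-δ (suc n) {zero} g _ =
    ≈-trans (+-cong (*-identityˡ _) (∑-zero n (λ j _ → zeroˡ _))) (+-identityʳ _)
  ∑-δ (suc n) {suc k} g (s≤s k<n) =
    ≈-trans (+-cong (zeroˡ _) (∑-δ n (λ j → g (suc j)) k<n)) (+-identityˡ _)

module Determinants {c ℓ} (R : CommutativeRing c ℓ) where
  open CommutativeRing R hiding (zero) renaming (refl to ≈-refl; sym to ≈-sym; trans to ≈-trans)
  open Hankel R using (sgn; ε)
  open FiniteSums R
  open RingProperties ring using (-‿distribˡ-*; -0#≈0#; +-inverseʳ-unique; -‿involutive)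
  open import Algebra.Solver.Ring.NaturalCoefficients.Default commutativeSemiring using (solve; _:+_; _:*_; _:=_)
  open import Relation.Binary.Reasoning.Setoid setoid

  sgn-+ : ∀ i j → sgn (i ℕ.+ j) ≈ sgn i * sgn j
  sgn-+ zero    j = ≈-sym (*-identityˡ _)
  sgn-+ (suc i) j = ≈-trans (-‿cong (sgn-+ i j)) (-‿distribˡ-* _ _)

  ε-suc : ∀ m → ε (suc m) ≈ sgn (suc m) * ε m
  ε-suc m = ≈-trans (reflexive (≡.cong sgn pascal)) (sgn-+ (suc m) (suc m C 2))
    where
    pascal : suc (suc m) C 2 ≡ suc m ℕ.+ suc m C 2
    pascal = ≡.trans (≡.sym (nCk+nC[k+1]≡[n+1]C[k+1] (suc m) 1)) (≡.cong (ℕ._+ suc m C 2) (nC1≡n (suc m)))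

  -- Indexing by ℕ rather than Fin avoids casts between sizes such as n + m + 1 and suc m + n;
  -- only the entries below the size matter (det-cong).
  Matrix : Set c
  Matrix = ℕ → ℕ → Carrier

  minor : ℕ → Matrix → Matrix
  minor j F i k = F (suc i) (punchIn j k)

  det : ℕ → Matrix → Carrier
  cofactorTerm : ℕ → Matrix → ℕ → Carrier

  det zero    F = 1#
  det (suc n) F = ∑ (suc n) (cofactorTerm n F)

  cofactorTerm n F j = sgn j * F 0 j * det n (minor j F)

  Hankel-det≈det : ∀ n (M : Fin n → Fin n → Carrier) (F : Matrix) →
                   (∀ i j → M i j ≈ F (toℕ i) (toℕ j)) → Hankel.det R n M ≈ det n F
  Hankel-det≈det zero    M F M≈F = ≈-refl
  Hankel-det≈det (suc n) M F M≈F = ∑-fromFin (suc n) {g = cofactorTerm n F} λ j →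
    *-cong (*-cong ≈-refl (M≈F Fin.zero j))
           (Hankel-det≈det n _ _ λ i k →
             ≈-trans (M≈F (Fin.suc i) (Fin.punchIn j k)) (reflexive (≡.cong (F (suc (toℕ i))) (toℕ-punchIn j k))))
    where
    ∑-fromFin : ∀ n {f : Fin n → Carrier} {g} → (∀ j → f j ≈ g (toℕ j)) → Hankel.Σ R n f ≈ ∑ n g
    ∑-fromFin zero    f≈g = ≈-refl
    ∑-fromFin (suc n) f≈g = +-cong (f≈g Fin.zero) (∑-fromFin n (f≈g ∘ Fin.suc))

  det-cong : ∀ n {F G : Matrix} → (∀ i j → i < n → j < n → F i j ≈ G i j) → det n F ≈ det n G
  det-cong zero    F≈G = ≈-refl
  det-cong (suc n) {F} {G} F≈G = ∑-cong (suc n) {cofactorTerm n F} {cofactorTerm n G} λ j j<n →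
    *-cong (*-congˡ (F≈G 0 j (s≤s z≤n) j<n))
           (det-cong n λ i k i<n k<n → F≈G (suc i) (punchIn j k) (s≤s i<n) (punchIn-bound j k<n))

  det-linear : ∀ n c {F G H : Matrix} x y → c < n
    → (∀ i j → j ≢ c → F i j ≈ G i j) → (∀ i j → j ≢ c → F i j ≈ H i j)
    → (∀ i → F i c ≈ x * G i c + y * H i c)
    → det n F ≈ x * det n G + y * det n H
  det-linear (suc n) c {F} {G} {H} x y c<n F≈G F≈H Fc≈ = begin
    ∑ (suc n) (cofactorTerm n F)
      ≈⟨ ∑-cong (suc n) (λ j j<n → expand j j<n) ⟩
    ∑ (suc n) (λ j → x * cofactorTerm n G j + y * cofactorTerm n H j)
      ≈⟨ ∑-distrib-+ (suc n) (λ j → x * cofactorTerm n G j) (λ j → y * cofactorTerm n H j) ⟩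
    ∑ (suc n) (λ j → x * cofactorTerm n G j) + ∑ (suc n) (λ j → y * cofactorTerm n H j)
      ≈⟨ +-cong (∑-distribˡ (suc n) x (cofactorTerm n G)) (∑-distribˡ (suc n) y (cofactorTerm n H)) ⟩
    x * det (suc n) G + y * det (suc n) H ∎
    where
    expand : ∀ j → j < suc n → cofactorTerm n F j ≈ x * cofactorTerm n G j + y * cofactorTerm n H j
    expand j j<n with j ≟ c
    ... | yes refl = begin
      sgn j * F 0 j * det n (minor j F)
        ≈⟨ *-cong (*-congˡ (Fc≈ 0)) ≈-refl ⟩
      sgn j * (x * G 0 j + y * H 0 j) * det n (minor j F)
        ≈⟨ distribute _ _ _ _ _ _ ⟩
      x * (sgn j * G 0 j * det n (minor j F)) + y * (sgn j * H 0 j * det n (minor j F))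
        ≈⟨ +-cong (*-congˡ (*-congˡ (det-cong n λ i k _ _ → F≈G (suc i) (punchIn j k) (punchInᵢ≢i j k))))
                  (*-congˡ (*-congˡ (det-cong n λ i k _ _ → F≈H (suc i) (punchIn j k) (punchInᵢ≢i j k)))) ⟩
      x * cofactorTerm n G j + y * cofactorTerm n H j ∎
      where
      distribute : ∀ s x g y h d → s * (x * g + y * h) * d ≈ x * (s * g * d) + y * (s * h * d)
      distribute = solve 6 (λ s x g y h d → s :* (x :* g :+ y :* h) :* d := x :* (s :* g :* d) :+ y :* (s :* h :* d)) ≈-refl
    ... | no j≢c = begin
      sgn j * F 0 j * det n (minor j F)
        ≈⟨ *-congˡ (det-linear n c′ x y (punchOut-< j<n c<n j≢c) (off F≈G) (off F≈H) minorFc≈) ⟩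
      sgn j * F 0 j * (x * det n (minor j G) + y * det n (minor j H))
        ≈⟨ distribute _ _ _ _ _ _ ⟩
      x * (sgn j * F 0 j * det n (minor j G)) + y * (sgn j * F 0 j * det n (minor j H))
        ≈⟨ +-cong (*-congˡ (*-congʳ (*-congˡ (F≈G 0 j j≢c)))) (*-congˡ (*-congʳ (*-congˡ (F≈H 0 j j≢c)))) ⟩
      x * cofactorTerm n G j + y * cofactorTerm n H j ∎
      where
      c′ = punchOut j c
      distribute : ∀ s f x g y h → s * f * (x * g + y * h) ≈ x * (s * f * g) + y * (s * f * h)
      distribute = solve 6 (λ s f x g y h → s :* f :* (x :* g :+ y :* h) := x :* (s :* f :* g) :+ y :* (s :* f :* h)) ≈-refl
      off : ∀ {K} → (∀ i l → l ≢ c → F i l ≈ K i l) → ∀ i k → k ≢ c′ → minor j F i k ≈ minor j K i k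
      off F≈K i k k≢c′ = F≈K (suc i) (punchIn j k) λ eq →
        k≢c′ (punchIn-injective j k c′ (≡.trans eq (≡.sym (punchIn-punchOut j≢c))))
      minorFc≈ : ∀ i → minor j F i c′ ≈ x * minor j G i c′ + y * minor j H i c′
      minorFc≈ i rewrite punchIn-punchOut j≢c = Fc≈ (suc i)

  det-zero-first-row : ∀ n {F : Matrix} → (∀ j → j < suc n → F 0 j ≈ 0#) → det (suc n) F ≈ 0#
  det-zero-first-row n {F} F0≈0 = ∑-zero (suc n) {cofactorTerm n F} λ j j<n →
    ≈-trans (*-congʳ (≈-trans (*-congˡ (F0≈0 j j<n)) (zeroʳ _))) (zeroˡ _)

  det-zero-column : ∀ n c {F : Matrix} → c < n → (∀ i → F i c ≈ 0#) → det n F ≈ 0#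
  det-zero-column n c c<n Fc≈0 =
    ≈-trans (det-linear n c 0# 0# c<n (λ _ _ _ → ≈-refl) (λ _ _ _ → ≈-refl) (λ i → ≈-trans (Fc≈0 i) (≈-sym 0*+0*≈0)))
            0*+0*≈0
    where
    0*+0*≈0 : ∀ {u v} → 0# * u + 0# * v ≈ 0#
    0*+0*≈0 = ≈-trans (+-cong (zeroˡ _) (zeroˡ _)) (+-identityˡ 0#)

  det-adjacent-columns-equal : ∀ n c {F : Matrix} → suc c < n → (∀ i → F i c ≈ F i (suc c)) → det n F ≈ 0#
  det-adjacent-columns-equal (suc n) c {F} 1+c<n Fc≈ = ∑-adjacent-cancel (suc n) c (cofactorTerm n F) 1+c<n others pair
    where
    others : ∀ j → j < suc n → j ≢ c → j ≢ suc c → cofactorTerm n F j ≈ 0#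
    others j j<n j≢c j≢1+c = ≈-trans (*-congˡ (det-adjacent-columns-equal n (punchOut j c) bound minorFc≈)) (zeroʳ _)
      where
      bound : suc (punchOut j c) < n
      bound = ≡.subst (_< n) (punchOut-suc j≢c j≢1+c) (punchOut-< j<n 1+c<n j≢1+c)
      minorFc≈ : ∀ i → F (suc i) (punchIn j (punchOut j c)) ≈ F (suc i) (punchIn j (suc (punchOut j c)))
      minorFc≈ i rewrite ≡.sym (punchOut-suc j≢c j≢1+c) | punchIn-punchOut j≢c | punchIn-punchOut j≢1+c = Fc≈ (suc i)
    minor≈minor : ∀ i k → minor c F i k ≈ minor (suc c) F i k
    minor≈minor i k with punchIn-adjacent c k
    ... | inj₁ eq         = reflexive (≡.cong (F (suc i)) eq)
    ... | inj₂ (eq , eq′) rewrite eq | eq′ = ≈-sym (Fc≈ (suc i))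
    pair : cofactorTerm n F c + cofactorTerm n F (suc c) ≈ 0#
    pair = begin
      cofactorTerm n F c + (- sgn c) * F 0 (suc c) * det n (minor (suc c) F)
        ≈⟨ +-congˡ (≈-trans (*-congʳ (≈-sym (-‿distribˡ-* _ _))) (≈-sym (-‿distribˡ-* _ _))) ⟩
      cofactorTerm n F c + - (sgn c * F 0 (suc c) * det n (minor (suc c) F))
        ≈⟨ +-congˡ (-‿cong (*-cong (*-congˡ (≈-sym (Fc≈ 0))) (det-cong n λ i k _ _ → ≈-sym (minor≈minor i k)))) ⟩
      cofactorTerm n F c + - cofactorTerm n F c
        ≈⟨ -‿inverseʳ _ ⟩
      0# ∎

  replaceColumn : ℕ → (ℕ → Carrier) → Matrix → Matrix
  replaceColumn c u F i j with j ≟ c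
  ... | yes _ = u i
  ... | no  _ = F i j

  replaceColumn-≡ : ∀ c u F i → replaceColumn c u F i c ≡ u i
  replaceColumn-≡ c u F i with c ≟ c
  ... | yes _   = refl
  ... | no  c≢c = ⊥-elim (c≢c refl)

  replaceColumn-≢ : ∀ {c j} u F i → j ≢ c → replaceColumn c u F i j ≡ F i j
  replaceColumn-≢ {c} {j} u F i j≢c with j ≟ c
  ... | yes j≡c = ⊥-elim (j≢c j≡c)
  ... | no  _   = refl

  module _ (c : ℕ) (F : Matrix) where
    private
      replaceAdjacent : (ℕ → Carrier) → (ℕ → Carrier) → Matrix
      replaceAdjacent u v = replaceColumn c u (replaceColumn (suc c) v F)

      replaceAdjacent-c : ∀ u v i → replaceAdjacent u v i c ≡ u i
      replaceAdjacent-c u v i = replaceColumn-≡ c u _ i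

      replaceAdjacent-suc : ∀ u v i → replaceAdjacent u v i (suc c) ≡ v i
      replaceAdjacent-suc u v i =
        ≡.trans (replaceColumn-≢ u _ i (ℕ.1+n≢n {c})) (replaceColumn-≡ (suc c) v F i)

      replaceAdjacent-≢c : ∀ u u′ v i j → j ≢ c → replaceAdjacent u v i j ≡ replaceAdjacent u′ v i j
      replaceAdjacent-≢c u u′ v i j j≢c = ≡.trans (replaceColumn-≢ u _ i j≢c) (≡.sym (replaceColumn-≢ u′ _ i j≢c))

      replaceAdjacent-≢suc : ∀ u v v′ i j → j ≢ suc c → replaceAdjacent u v i j ≡ replaceAdjacent u v′ i j
      replaceAdjacent-≢suc u v v′ i j j≢1+c with j ≟ c
      ... | yes _ = refl
      ... | no  _ = ≡.trans (replaceColumn-≢ v F i j≢1+c) (≡.sym (replaceColumn-≢ v′ F i j≢1+c))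

      det-replaceAdjacent-additive : ∀ n → suc c < n → ∀ u u′ v v′ →
        det n (replaceAdjacent (λ i → u i + u′ i) (λ i → v i + v′ i)) ≈
          (det n (replaceAdjacent u v) + det n (replaceAdjacent u v′)) +
          (det n (replaceAdjacent u′ v) + det n (replaceAdjacent u′ v′))
      det-replaceAdjacent-additive n 1+c<n u u′ v v′ =
        ≈-trans (additive c (ℕ.<-trans (ℕ.n<1+n c) 1+c<n) (replaceAdjacent-≢c _ _ _) (replaceAdjacent-≢c _ _ _)
                          (λ i → reflexive (≡.trans (replaceAdjacent-c _ _ i)
                                   (≡.cong₂ _+_ (≡.sym (replaceAdjacent-c _ _ i)) (≡.sym (replaceAdjacent-c _ _ i))))))
                (+-cong (additive (suc c) 1+c<n (replaceAdjacent-≢suc _ _ _) (replaceAdjacent-≢suc _ _ _) (split u))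
                        (additive (suc c) 1+c<n (replaceAdjacent-≢suc _ _ _) (replaceAdjacent-≢suc _ _ _) (split u′)))
        where
        additive : ∀ d {G H K : Matrix} → d < n → (∀ i j → j ≢ d → G i j ≡ H i j) → (∀ i j → j ≢ d → G i j ≡ K i j)
          → (∀ i → G i d ≈ H i d + K i d) → det n G ≈ det n H + det n K
        additive d d<n G≡H G≡K Gd≈ =
          ≈-trans (det-linear n d 1# 1# d<n (λ i j j≢d → reflexive (G≡H i j j≢d)) (λ i j j≢d → reflexive (G≡K i j j≢d))
                               (λ i → ≈-trans (Gd≈ i) (≈-sym (+-cong (*-identityˡ _) (*-identityˡ _)))))
                  (+-cong (*-identityˡ _) (*-identityˡ _))
        split : ∀ w i → replaceAdjacent w (λ i → v i + v′ i) i (suc c) ≈ replaceAdjacent w v i (suc c) + replaceAdjacent w v′ i (suc c)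
        split w i = reflexive (≡.trans (replaceAdjacent-suc _ _ i)
                      (≡.cong₂ _+_ (≡.sym (replaceAdjacent-suc _ _ i)) (≡.sym (replaceAdjacent-suc _ _ i))))

      det-replaceAdjacent-equal : ∀ n → suc c < n → ∀ u → det n (replaceAdjacent u u) ≈ 0#
      det-replaceAdjacent-equal n 1+c<n u = det-adjacent-columns-equal n c 1+c<n λ i →
        reflexive (≡.trans (replaceAdjacent-c u u i) (≡.sym (replaceAdjacent-suc u u i)))

    swapAdjacentColumns : Matrix
    swapAdjacentColumns = replaceAdjacent (λ i → F i (suc c)) (λ i → F i c)

    -- Expand, by linearity, the determinant with u + v in both columns.
    det-swapAdjacentColumns : ∀ n → suc c < n → det n swapAdjacentColumns ≈ - det n F
    det-swapAdjacentColumns n 1+c<n = +-inverseʳ-unique _ _ (≈-sym (begin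
      0#                                      ≈⟨ det-replaceAdjacent-equal n 1+c<n w ⟨
      det n (replaceAdjacent w w)             ≈⟨ det-replaceAdjacent-additive n 1+c<n u v u v ⟩
      (det n (replaceAdjacent u u) + det n (replaceAdjacent u v)) +
      (det n (replaceAdjacent v u) + det n (replaceAdjacent v v))
        ≈⟨ +-cong (+-cong (det-replaceAdjacent-equal n 1+c<n u) (det-cong n λ i j _ _ → reflexive (unchanged i j)))
                  (+-congˡ (det-replaceAdjacent-equal n 1+c<n v)) ⟩
      (0# + det n F) + (det n swapAdjacentColumns + 0#)
        ≈⟨ +-cong (+-identityˡ _) (+-identityʳ _) ⟩
      det n F + det n swapAdjacentColumns     ∎))
      where
      u v w : ℕ → Carrier
      u i = F i c
      v i = F i (suc c)
      w i = u i + v i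
      unchanged : ∀ i j → replaceAdjacent u v i j ≡ F i j
      unchanged i j with j ≟ c
      ... | yes refl = refl
      ... | no  j≢c with j ≟ suc c
      ...   | yes refl = refl
      ...   | no  j≢1+c = refl

  det-equal-columns : ∀ n {c} e {F : Matrix} → c < e → e < n → (∀ i → F i c ≈ F i e) → det n F ≈ 0#
  det-equal-columns n {c} (suc e) {F} (s≤s c≤e) 1+e<n Fc≈ with ℕ.m≤n⇒m<n∨m≡n c≤e
  ... | inj₂ refl = det-adjacent-columns-equal n c 1+e<n Fc≈
  ... | inj₁ c<e  = begin
    det n F                          ≈⟨ -‿involutive _ ⟨
    - - det n F                      ≈⟨ -‿cong (det-swapAdjacentColumns e F n 1+e<n) ⟨
    - det n (swapAdjacentColumns e F) ≈⟨ -‿cong (det-equal-columns n e c<e (ℕ.<-trans (ℕ.n<1+n e) 1+e<n) swappedc≈) ⟩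
    - 0#                             ≈⟨ -0#≈0# ⟩
    0#                               ∎
    where
    swappedc≈ : ∀ i → swapAdjacentColumns e F i c ≈ swapAdjacentColumns e F i e
    swappedc≈ i = begin
      swapAdjacentColumns e F i c ≡⟨ replaceColumn-≢ _ _ i (ℕ.<⇒≢ c<e) ⟩
      replaceColumn (suc e) (λ k → F k e) F i c ≡⟨ replaceColumn-≢ _ F i (ℕ.<⇒≢ (ℕ.m<n⇒m<1+n c<e)) ⟩
      F i c                        ≈⟨ Fc≈ i ⟩
      F i (suc e)                  ≡⟨ replaceColumn-≡ e _ _ i ⟨
      swapAdjacentColumns e F i e  ∎

  det-add-column-multiple : ∀ n {j r} {F G : Matrix} x → j < n → r < n → r ≢ j
    → (∀ i k → k ≢ j → G i k ≈ F i k) → (∀ i → G i j ≈ F i j + x * F i r) → det n G ≈ det n F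
  det-add-column-multiple n {j} {r} {F} {G} x j<n r<n r≢j G≈F Gj≈ = begin
    det n G                         ≈⟨ det-linear n j 1# x j<n G≈F G≈H Gj≈′ ⟩
    1# * det n F + x * det n H      ≈⟨ +-cong (*-identityˡ _) (≈-trans (*-congˡ detH≈0) (zeroʳ x)) ⟩
    det n F + 0#                    ≈⟨ +-identityʳ _ ⟩
    det n F                         ∎
    where
    H = replaceColumn j (λ i → F i r) F
    G≈H : ∀ i k → k ≢ j → G i k ≈ H i k
    G≈H i k k≢j = ≈-trans (G≈F i k k≢j) (reflexive (≡.sym (replaceColumn-≢ _ F i k≢j)))
    Gj≈′ : ∀ i → G i j ≈ 1# * F i j + x * H i j
    Gj≈′ i = ≈-trans (Gj≈ i) (+-cong (≈-sym (*-identityˡ _)) (*-congˡ (reflexive (≡.sym (replaceColumn-≡ j _ F i)))))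
    Hr≈Hj : ∀ i → H i r ≈ H i j
    Hr≈Hj i = reflexive (≡.trans (replaceColumn-≢ _ F i r≢j) (≡.sym (replaceColumn-≡ j _ F i)))
    detH≈0 : det n H ≈ 0#
    detH≈0 with ℕ.<-cmp r j
    ... | tri< r<j _ _ = det-equal-columns n j r<j j<n Hr≈Hj
    ... | tri≈ _ r≡j _ = ⊥-elim (r≢j r≡j)
    ... | tri> _ _ j<r = det-equal-columns n r j<r r<n (≈-sym ∘ Hr≈Hj)

  det-add-earlier-columns : ∀ n k {j} {F G : Matrix} (w : ℕ → Carrier) → k ≤ j → j < n
    → (∀ i l → l ≢ j → G i l ≈ F i l) → (∀ i → G i j ≈ F i j + ∑ k (λ r → w r * F i r)) → det n G ≈ det n F
  det-add-earlier-columns n zero {j} {F} {G} w _ _ G≈F Gj≈ = det-cong n G≈F′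
    where
    G≈F′ : ∀ i l → i < n → l < n → G i l ≈ F i l
    G≈F′ i l _ _ with l ≟ j
    ... | yes refl = ≈-trans (Gj≈ i) (+-identityʳ _)
    ... | no  l≢j  = G≈F i l l≢j
  det-add-earlier-columns n (suc k) {j} {F} {G} w k<j j<n G≈F Gj≈ = begin
    det n G  ≈⟨ det-add-column-multiple n (w k) j<n (ℕ.<-trans k<j j<n) (ℕ.<⇒≢ k<j) G≈G′ Gj≈′ ⟩
    det n G′ ≈⟨ det-add-earlier-columns n k w (ℕ.<⇒≤ k<j) j<n (λ i l l≢j → reflexive (replaceColumn-≢ _ F i l≢j))
                                                              (λ i → reflexive (replaceColumn-≡ j _ F i)) ⟩
    det n F  ∎
    where
    G′ = replaceColumn j (λ i → F i j + ∑ k (λ r → w r * F i r)) F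
    G≈G′ : ∀ i l → l ≢ j → G i l ≈ G′ i l
    G≈G′ i l l≢j = ≈-trans (G≈F i l l≢j) (reflexive (≡.sym (replaceColumn-≢ _ F i l≢j)))
    Gj≈′ : ∀ i → G i j ≈ G′ i j + w k * G′ i k
    Gj≈′ i = begin
      G i j                                                   ≈⟨ Gj≈ i ⟩
      F i j + ∑ (suc k) (λ r → w r * F i r)                   ≈⟨ +-congˡ (∑-last k _) ⟩
      F i j + (∑ k (λ r → w r * F i r) + w k * F i k)         ≈⟨ +-assoc _ _ _ ⟨
      (F i j + ∑ k (λ r → w r * F i r)) + w k * F i k
        ≈⟨ +-cong (reflexive (≡.sym (replaceColumn-≡ j _ F i))) (*-congˡ (reflexive (≡.sym (replaceColumn-≢ _ F i (ℕ.<⇒≢ k<j))))) ⟩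
      G′ i j + w k * G′ i k                                   ∎

  det-unitriangular : ∀ n (L : ℕ → ℕ → Carrier) {F G : Matrix}
    → (∀ i j → G i j ≈ F i j + ∑ j (λ r → L j r * F i r)) → det n G ≈ det n F
  det-unitriangular n L {F} {G} G≈ = ≈-trans (det-cong n (λ i j _ _ → reflexive (≡.sym (mixed-≥ z≤n)))) (from n 0 (ℕ.+-identityʳ n))
    where
    mixed : ℕ → Matrix
    mixed t i j with t ≤? j
    ... | yes _ = G i j
    ... | no  _ = F i j

    mixed-≥ : ∀ {t i j} → t ≤ j → mixed t i j ≡ G i j
    mixed-≥ {t} {i} {j} t≤j with t ≤? j
    ... | yes _   = refl
    ... | no  t≰j = ⊥-elim (t≰j t≤j)

    mixed-< : ∀ {t i j} → j < t → mixed t i j ≡ F i j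
    mixed-< {t} {i} {j} j<t with t ≤? j
    ... | yes t≤j = ⊥-elim (ℕ.<⇒≱ j<t t≤j)
    ... | no  _   = refl

    step : ∀ t → t < n → det n (mixed t) ≈ det n (mixed (suc t))
    step t t<n = det-add-earlier-columns n t (L t) ℕ.≤-refl t<n off diagonal
      where
      off : ∀ i l → l ≢ t → mixed t i l ≈ mixed (suc t) i l
      off i l l≢t with ℕ.<-cmp l t
      ... | tri< l<t _ _ = reflexive (≡.trans (mixed-< l<t) (≡.sym (mixed-< (ℕ.m<n⇒m<1+n l<t))))
      ... | tri≈ _ l≡t _ = ⊥-elim (l≢t l≡t)
      ... | tri> _ _ t<l = reflexive (≡.trans (mixed-≥ (ℕ.<⇒≤ t<l)) (≡.sym (mixed-≥ t<l)))
      diagonal : ∀ i → mixed t i t ≈ mixed (suc t) i t + ∑ t (λ r → L t r * mixed (suc t) i r)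
      diagonal i = begin
        mixed t i t                                   ≡⟨ mixed-≥ ℕ.≤-refl ⟩
        G i t                                         ≈⟨ G≈ i t ⟩
        F i t + ∑ t (λ r → L t r * F i r)
          ≈⟨ +-cong (reflexive (≡.sym (mixed-< ℕ.≤-refl)))
                    (∑-cong t λ r r<t → *-congˡ (reflexive (≡.sym (mixed-< (ℕ.m<n⇒m<1+n r<t))))) ⟩
        mixed (suc t) i t + ∑ t (λ r → L t r * mixed (suc t) i r) ∎

    from : ∀ d t → d ℕ.+ t ≡ n → det n (mixed t) ≈ det n F
    from zero    t refl = det-cong n λ i j _ j<t → reflexive (mixed-< j<t)
    from (suc d) t d+t≡n =
      ≈-trans (step t (ℕ.≤-trans (ℕ.m≤n+m (suc t) d) (ℕ.≤-reflexive (≡.trans (ℕ.+-suc d t) d+t≡n))))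
              (from d (suc t) (≡.trans (ℕ.+-suc d t) d+t≡n))

  det-unit-first-column : ∀ n k {F : Matrix} → k < suc n → (∀ p → F p 0 ≈ δ p k)
    → det (suc n) F ≈ sgn k * det n (λ p q → F (punchIn k p) (suc q))
  det-unit-first-column zero    zero    {F} _ F0≈ =
    ≈-trans (+-identityʳ _) (*-congʳ (≈-trans (*-congˡ (F0≈ 0)) (*-identityʳ _)))
  det-unit-first-column zero    (suc k) (s≤s ()) _
  det-unit-first-column (suc n) zero    {F} _ F0≈ = begin
    cofactorTerm (suc n) F 0 + ∑ (suc n) (λ j → cofactorTerm (suc n) F (suc j))
      ≈⟨ +-congˡ (∑-zero (suc n) {λ j → cofactorTerm (suc n) F (suc j)} λ j _ → ≈-trans (*-congˡ (det-zero-column (suc n) 0 {minor (suc j) F} (s≤s z≤n) (F0≈ ∘ suc))) (zeroʳ _)) ⟩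
    cofactorTerm (suc n) F 0 + 0#             ≈⟨ +-identityʳ _ ⟩
    1# * F 0 0 * det (suc n) (minor 0 F)     ≈⟨ *-congʳ (*-congˡ (F0≈ 0)) ⟩
    1# * 1# * det (suc n) (minor 0 F)        ≈⟨ *-congʳ (*-identityʳ 1#) ⟩
    1# * det (suc n) (minor 0 F)             ∎
  det-unit-first-column (suc n) (suc k) {F} (s≤s k<n) F0≈ = begin
    sgn 0 * F 0 0 * det (suc n) (minor 0 F) + ∑ (suc n) (λ j → cofactorTerm (suc n) F (suc j))
      ≈⟨ +-cong (≈-trans (*-congʳ (≈-trans (*-congˡ (F0≈ 0)) (zeroʳ _))) (zeroˡ _))
                (∑-cong (suc n) {λ j → cofactorTerm (suc n) F (suc j)} λ j _ →
                   *-congˡ (det-unit-first-column n k {minor (suc j) F} k<n (F0≈ ∘ suc))) ⟩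
    0# + ∑ (suc n) (λ j → sgn (suc j) * F 0 (suc j) * (sgn k * Y j))   ≈⟨ +-identityˡ _ ⟩
    ∑ (suc n) (λ j → sgn (suc j) * F 0 (suc j) * (sgn k * Y j))        ≈⟨ ∑-cong (suc n) {λ j → - sgn j * F 0 (suc j) * (sgn k * Y j)} (λ j _ → swapSigns j) ⟩
    ∑ (suc n) (λ j → - sgn k * (sgn j * F 0 (suc j) * Y j))           ≈⟨ ∑-distribˡ (suc n) (- sgn k) (λ j → sgn j * F 0 (suc j) * Y j) ⟩
    - sgn k * ∑ (suc n) (λ j → sgn j * F 0 (suc j) * Y j)             ∎
    where
    Y : ℕ → Carrier
    Y j = det n (λ p q → F (suc (punchIn k p)) (suc (punchIn j q)))
    exchange : ∀ a x b y → a * x * (b * y) ≈ b * (a * x * y)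
    exchange = solve 4 (λ a x b y → a :* x :* (b :* y) := b :* (a :* x :* y)) ≈-refl
    swapSigns : ∀ j → - sgn j * F 0 (suc j) * (sgn k * Y j) ≈ - sgn k * (sgn j * F 0 (suc j) * Y j)
    swapSigns j = begin
      - sgn j * F 0 (suc j) * (sgn k * Y j)    ≈⟨ *-congʳ (-‿distribˡ-* _ _) ⟨
      - (sgn j * F 0 (suc j)) * (sgn k * Y j)  ≈⟨ -‿distribˡ-* _ _ ⟨
      - (sgn j * F 0 (suc j) * (sgn k * Y j))  ≈⟨ -‿cong (exchange _ _ _ _) ⟩
      - (sgn k * (sgn j * F 0 (suc j) * Y j))  ≈⟨ -‿distribˡ-* _ _ ⟩
      - sgn k * (sgn j * F 0 (suc j) * Y j)    ∎

  det-column-∑ : ∀ n c K {F G : Matrix} (x : ℕ → Carrier) (v : ℕ → ℕ → Carrier) → c < n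
    → (∀ i j → j ≢ c → G i j ≈ F i j) → (∀ i → G i c ≈ ∑ K (λ k → x k * v k i))
    → det n G ≈ ∑ K (λ k → x k * det n (replaceColumn c (v k) F))
  det-column-∑ n c zero    x v c<n G≈F Gc≈ = det-zero-column n c c<n Gc≈
  det-column-∑ n c (suc K) {F} {G} x v c<n G≈F Gc≈ = begin
    det n G
      ≈⟨ det-linear n c (x 0) 1# c<n (λ i j j≢c → ≈-trans (G≈F i j j≢c) (reflexive (≡.sym (replaceColumn-≢ _ F i j≢c))))
                                      (λ i j j≢c → ≈-trans (G≈F i j j≢c) (reflexive (≡.sym (replaceColumn-≢ _ F i j≢c))))
                                      Gc≈′ ⟩
    x 0 * det n (replaceColumn c (v 0) F) + 1# * det n rest
      ≈⟨ +-congˡ (≈-trans (*-identityˡ _)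
           (det-column-∑ n c K (x ∘ suc) (v ∘ suc) c<n (λ i j j≢c → reflexive (replaceColumn-≢ _ F i j≢c))
                                                        (λ i → reflexive (replaceColumn-≡ c _ F i)))) ⟩
    x 0 * det n (replaceColumn c (v 0) F) + ∑ K (λ k → x (suc k) * det n (replaceColumn c (v (suc k)) F)) ∎
    where
    rest = replaceColumn c (λ i → ∑ K (λ k → x (suc k) * v (suc k) i)) F
    Gc≈′ : ∀ i → G i c ≈ x 0 * replaceColumn c (v 0) F i c + 1# * rest i c
    Gc≈′ i = ≈-trans (Gc≈ i) (+-cong (*-congˡ (reflexive (≡.sym (replaceColumn-≡ c _ F i))))
                                     (≈-sym (≈-trans (*-identityˡ _) (reflexive (replaceColumn-≡ c _ F i)))))

  det-expand-first-column : ∀ n (F : Matrix) →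
    det (suc n) F ≈ ∑ (suc n) (λ i → sgn i * F i 0 * det n (λ p q → F (punchIn i p) (suc q)))
  det-expand-first-column n F = begin
    det (suc n) F
      ≈⟨ det-cong (suc n) (λ i j i<n _ → F≈G i j i<n) ⟩
    det (suc n) G
      ≈⟨ det-column-∑ (suc n) 0 (suc n) {F} {G} (λ k → F k 0) unit (s≤s z≤n)
                      (λ i j j≢0 → reflexive (replaceColumn-≢ column0 F i j≢0)) (λ i → reflexive (replaceColumn-≡ 0 column0 F i)) ⟩
    ∑ (suc n) (λ k → F k 0 * det (suc n) (replaceColumn 0 (unit k) F))
      ≈⟨ ∑-cong (suc n) (λ k k<n → expandUnit k k<n) ⟩
    ∑ (suc n) (λ i → sgn i * F i 0 * det n (λ p q → F (punchIn i p) (suc q))) ∎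
    where
    unit : ℕ → ℕ → Carrier
    unit k p = δ p k
    column0 : ℕ → Carrier
    column0 p = ∑ (suc n) (λ k → F k 0 * δ p k)
    G = replaceColumn 0 column0 F
    F≈G : ∀ i j → i < suc n → F i j ≈ G i j
    F≈G i zero i<n = begin
      F i 0                                 ≈⟨ ∑-δ (suc n) (λ k → F k 0) i<n ⟨
      ∑ (suc n) (λ k → δ k i * F k 0)       ≈⟨ ∑-cong (suc n) {λ k → δ k i * F k 0} (λ k _ →
                                                 ≈-trans (*-comm _ _) (*-congˡ (reflexive (δ-sym k i)))) ⟩
      column0 i                             ≡⟨ replaceColumn-≡ 0 column0 F i ⟨
      G i 0                                 ∎
    F≈G i (suc j) _ = reflexive (≡.sym (replaceColumn-≢ {0} column0 F i (λ ())))
    expandUnit : ∀ k → k < suc n →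
      F k 0 * det (suc n) (replaceColumn 0 (unit k) F) ≈ sgn k * F k 0 * det n (λ p q → F (punchIn k p) (suc q))
    expandUnit k k<n = begin
      F k 0 * det (suc n) (replaceColumn 0 (unit k) F)
        ≈⟨ *-congˡ (det-unit-first-column n k {replaceColumn 0 (unit k) F} k<n (λ p → reflexive (replaceColumn-≡ 0 (unit k) F p))) ⟩
      F k 0 * (sgn k * det n (λ p q → replaceColumn 0 (unit k) F (punchIn k p) (suc q)))
        ≈⟨ *-congˡ (*-congˡ (det-cong n (λ p q _ _ → reflexive (replaceColumn-≢ {0} (unit k) F _ (λ ()))))) ⟩
      F k 0 * (sgn k * det n (λ p q → F (punchIn k p) (suc q)))
        ≈⟨ rotate _ _ _ ⟩
      sgn k * F k 0 * det n (λ p q → F (punchIn k p) (suc q)) ∎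
      where
      rotate : ∀ a b d → a * (b * d) ≈ b * a * d
      rotate = solve 3 (λ a b d → a :* (b :* d) := b :* a :* d) ≈-refl

  det-transpose : ∀ n (F : Matrix) → det n (λ i j → F j i) ≈ det n F
  det-transpose zero    F = ≈-refl
  det-transpose (suc n) F = ≈-trans
    (∑-cong (suc n) {cofactorTerm n (λ i j → F j i)} (λ j _ → *-congˡ (det-transpose n (λ p q → F (punchIn j p) (suc q)))))
    (≈-sym (det-expand-first-column n F))

  det-unit-first-row : ∀ n k {F : Matrix} → k < suc n → (∀ j → j < suc n → F 0 j ≈ δ j k)
    → det (suc n) F ≈ sgn k * det n (minor k F)
  det-unit-first-row n k {F} k<n F0≈ = ≈-trans
    (∑-cong (suc n) {cofactorTerm n F} {λ j → δ j k * (sgn j * det n (minor j F))}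
            (λ j j<n → ≈-trans (*-congʳ (*-congˡ (F0≈ j j<n))) (rotate _ _ _)))
    (∑-δ (suc n) (λ j → sgn j * det n (minor j F)) k<n)
    where
    rotate : ∀ a b d → a * b * d ≈ b * (a * d)
    rotate = solve 3 (λ a b d → a :* b :* d := b :* (a :* d)) ≈-refl

  δ-punchIn : ∀ m i j → δ (i ℕ.+ punchIn (suc m) j) m ≡ δ (i ℕ.+ j) m
  δ-punchIn m i j with j ℕ.≤? m
  ... | yes j≤m = ≡.cong (λ k → δ (i ℕ.+ k) m) (punchIn-below (s≤s j≤m))
  ... | no  j≰m = ≡.trans (δ-≢ (ℕ.>⇒≢ m<i+1+j)) (≡.sym (δ-≢ (ℕ.>⇒≢ m<i+j)))
    where
    m<j : m < j
    m<j = ℕ.≰⇒> j≰m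
    m<i+j : m < i ℕ.+ j
    m<i+j = ℕ.<-≤-trans m<j (ℕ.m≤n+m j i)
    m<i+1+j : m < i ℕ.+ punchIn (suc m) j
    m<i+1+j rewrite punchIn-above m<j = ℕ.<-≤-trans (ℕ.m<n⇒m<1+n m<j) (ℕ.m≤n+m (suc j) i)

  det-antidiagonal-block : ∀ m n {G : Matrix} → (∀ i j → i ≤ m → G i j ≈ δ (i ℕ.+ j) m)
    → det (suc m ℕ.+ n) G ≈ ε m * det n (λ p q → G (suc m ℕ.+ p) (suc m ℕ.+ q))
  det-antidiagonal-block zero    n {G} G≈ = det-unit-first-row n 0 {G} (s≤s z≤n) (λ j _ → G≈ 0 j z≤n)
  det-antidiagonal-block (suc m) n {G} G≈ = begin
    det (suc (suc m ℕ.+ n)) G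
      ≈⟨ det-unit-first-row (suc m ℕ.+ n) (suc m) {G} (s≤s (ℕ.m≤m+n (suc m) n)) (λ j _ → G≈ 0 j z≤n) ⟩
    sgn (suc m) * det (suc m ℕ.+ n) (minor (suc m) G)
      ≈⟨ *-congˡ (det-antidiagonal-block m n {minor (suc m) G} minorG≈) ⟩
    sgn (suc m) * (ε m * det n (λ p q → G (suc (suc m ℕ.+ p)) (punchIn (suc m) (suc m ℕ.+ q))))
      ≈⟨ *-congˡ (*-congˡ (det-cong n λ p q _ _ → reflexive (≡.cong (G _) (punchIn-above (ℕ.m≤m+n (suc m) q))))) ⟩
    sgn (suc m) * (ε m * det n (λ p q → G (suc (suc m) ℕ.+ p) (suc (suc m) ℕ.+ q)))
      ≈⟨ *-assoc _ _ _ ⟨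
    sgn (suc m) * ε m * det n (λ p q → G (suc (suc m) ℕ.+ p) (suc (suc m) ℕ.+ q))
      ≈⟨ *-congʳ (ε-suc m) ⟨
    ε (suc m) * det n (λ p q → G (suc (suc m) ℕ.+ p) (suc (suc m) ℕ.+ q)) ∎
    where
    minorG≈ : ∀ i j → i ≤ m → minor (suc m) G i j ≈ δ (i ℕ.+ j) m
    minorG≈ i j i≤m = ≈-trans (G≈ (suc i) (punchIn (suc m) j) (s≤s i≤m)) (reflexive (δ-punchIn m i j))

module NegativeHankel {c ℓ} (R : CommutativeRing c ℓ) (s : ℕ → CommutativeRing.Carrier R) where
  open CommutativeRing R hiding (zero) renaming (refl to ≈-refl; sym to ≈-sym; trans to ≈-trans)
  open Hankel R using (ank; a; E; D; ε)
  open FiniteSums R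
  open Determinants R
  open RingProperties ring using (-‿distribˡ-*; -‿+-comm)
  open import Algebra.Solver.Ring.NaturalCoefficients.Default commutativeSemiring using (solve; _:+_; _:*_; _:=_)
  open import Relation.Binary.Reasoning.Setoid setoid

  α β : ℕ → Carrier
  α n = ank s n 0
  β n = ank (E s) n 0

  -- After its last visit to level 0 a path stays at level ≥ 1, where it is a path for E s.
  ank-lastReturn : ∀ n k → ank s (suc n) (suc k) ≈ ∑ (suc n) (λ j → ank (E s) j k * α (n ∸ j))
  ank-lastReturn zero k = begin
    ank s 0 k + s (suc k) * ank s 0 (suc k) + 0#  ≈⟨ +-identityʳ _ ⟩
    ank s 0 k + s (suc k) * 0#                    ≈⟨ +-congˡ (zeroʳ _) ⟩
    ank s 0 k + 0#                                ≈⟨ +-congʳ (≈-trans (reflexive (ank-zero k)) (≈-sym (*-identityʳ _))) ⟩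
    ank (E s) 0 k * 1# + 0#                       ∎
    where
    ank-zero : ∀ k → ank s 0 k ≡ ank (E s) 0 k
    ank-zero zero    = refl
    ank-zero (suc k) = refl
  ank-lastReturn (suc n) zero = begin
    α (suc n) + s 1 * ank s (suc n) 1 + ank s (suc n) 2
      ≈⟨ +-cong (+-congˡ (*-congˡ (ank-lastReturn n 0))) (ank-lastReturn n 1) ⟩
    α (suc n) + s 1 * ∑ (suc n) (λ j → f j * w j) + ∑ (suc n) (λ j → g j * w j)
      ≈⟨ +-assoc _ _ _ ⟩
    α (suc n) + (s 1 * ∑ (suc n) (λ j → f j * w j) + ∑ (suc n) (λ j → g j * w j))
      ≈⟨ +-cong (≈-sym (*-identityˡ _)) (≈-sym (∑-linear (suc n) (s 1) f g w)) ⟩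
    1# * α (suc n) + ∑ (suc n) (λ j → (s 1 * f j + g j) * w j) ∎
    where
    f g w : ℕ → Carrier
    f j = ank (E s) j 0
    g j = ank (E s) j 1
    w j = α (n ∸ j)
  ank-lastReturn (suc n) (suc k) = begin
    ank s (suc n) (suc k) + s (suc (suc k)) * ank s (suc n) (suc (suc k)) + ank s (suc n) (suc (suc (suc k)))
      ≈⟨ +-cong (+-cong (ank-lastReturn n k) (*-congˡ (ank-lastReturn n (suc k)))) (ank-lastReturn n (suc (suc k))) ⟩
    ∑ (suc n) (λ j → e j * w j) + s (suc (suc k)) * ∑ (suc n) (λ j → f j * w j) + ∑ (suc n) (λ j → g j * w j)
      ≈⟨ +-congʳ (≈-trans (+-comm _ _) (≈-sym (∑-linear (suc n) (s (suc (suc k))) f e w))) ⟩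
    ∑ (suc n) (λ j → (s (suc (suc k)) * f j + e j) * w j) + ∑ (suc n) (λ j → g j * w j)
      ≈⟨ ∑-distrib-+ (suc n) (λ j → (s (suc (suc k)) * f j + e j) * w j) (λ j → g j * w j) ⟨
    ∑ (suc n) (λ j → (s (suc (suc k)) * f j + e j) * w j + g j * w j)
      ≈⟨ ∑-cong (suc n) {λ j → (s (suc (suc k)) * f j + e j) * w j + g j * w j} (λ j _ → regroup _ _ _ _ _) ⟩
    ∑ (suc n) (λ j → (e j + s (suc (suc k)) * f j + g j) * w j)
      ≈⟨ +-identityˡ _ ⟨
    0# + ∑ (suc n) (λ j → (e j + s (suc (suc k)) * f j + g j) * w j)
      ≈⟨ +-congʳ (zeroˡ _) ⟨
    0# * α (suc n) + ∑ (suc n) (λ j → (e j + s (suc (suc k)) * f j + g j) * w j) ∎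
    where
    e f g w : ℕ → Carrier
    e j = ank (E s) j k
    f j = ank (E s) j (suc k)
    g j = ank (E s) j (suc (suc k))
    w j = α (n ∸ j)
    regroup : ∀ x f e g w → (x * f + e) * w + g * w ≈ (e + x * f + g) * w
    regroup = solve 5 (λ x f e g w → (x :* f :+ e) :* w :+ g :* w := (e :+ x :* f :+ g) :* w) ≈-refl

  -- The coefficients of 1 / A(x) = 1 − s₀x − x²B(x), with A and B the generating functions of α and β.
  recip : ℕ → Carrier
  recip zero          = 1#
  recip (suc zero)    = - s 0
  recip (suc (suc k)) = - β k

  recip-convolution : ∀ n → ∑ (suc n) (λ j → recip j * α (n ∸ j)) ≈ δ n 0
  recip-convolution zero = ≈-trans (+-identityʳ _) (*-identityˡ _)
  recip-convolution (suc zero) = begin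
    1# * (s 0 * 1# + 0#) + (- s 0 * 1# + 0#)   ≈⟨ +-cong (≈-trans (*-identityˡ _) (+-identityʳ _)) (+-identityʳ _) ⟩
    s 0 * 1# + - s 0 * 1#                       ≈⟨ distribʳ 1# _ _ ⟨
    (s 0 + - s 0) * 1#                          ≈⟨ *-congʳ (-‿inverseʳ _) ⟩
    0# * 1#                                     ≈⟨ zeroˡ 1# ⟩
    0#                                          ∎
  recip-convolution (suc (suc n)) = begin
    1# * α (suc (suc n)) + (- s 0 * α (suc n) + ∑ (suc n) (λ j → - β j * α (n ∸ j)))
      ≈⟨ +-cong (≈-trans (*-identityˡ _) (+-congˡ (ank-lastReturn n 0)))
                (+-cong (≈-sym (-‿distribˡ-* _ _))
                        (≈-trans (∑-cong (suc n) {λ j → - β j * α (n ∸ j)} (λ j _ → ≈-sym (-‿distribˡ-* _ _)))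
                                 (∑-neg (suc n) (λ j → β j * α (n ∸ j))))) ⟩
    (s 0 * α (suc n) + Σβα) + (- (s 0 * α (suc n)) + - Σβα)
      ≈⟨ +-congˡ (-‿+-comm _ _) ⟩
    (s 0 * α (suc n) + Σβα) + - (s 0 * α (suc n) + Σβα)
      ≈⟨ -‿inverseʳ _ ⟩
    0# ∎
    where
    Σβα = ∑ (suc n) (λ j → β j * α (n ∸ j))

  recip⋆ : (ℕ → Carrier) → ℕ → Carrier
  recip⋆ g j = ∑ (suc j) (λ r → recip (j ∸ r) * g r)

  recip⋆-cong : ∀ j {g h} → (∀ r → g r ≈ h r) → recip⋆ g j ≈ recip⋆ h j
  recip⋆-cong j {g} {h} g≈h = ∑-cong (suc j) {λ r → recip (j ∸ r) * g r} {λ r → recip (j ∸ r) * h r} (λ r _ → *-congˡ (g≈h r))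

  recip⋆-unitriangular : ∀ g j → recip⋆ g j ≈ g j + ∑ j (λ r → recip (j ∸ r) * g r)
  recip⋆-unitriangular g j = begin
    recip⋆ g j                                                   ≈⟨ ∑-last j (λ r → recip (j ∸ r) * g r) ⟩
    ∑ j (λ r → recip (j ∸ r) * g r) + recip (j ∸ j) * g j        ≈⟨ +-congˡ (*-congʳ (reflexive (≡.cong recip (ℕ.n∸n≡0 j)))) ⟩
    ∑ j (λ r → recip (j ∸ r) * g r) + 1# * g j                   ≈⟨ +-comm _ _ ⟩
    1# * g j + ∑ j (λ r → recip (j ∸ r) * g r)                   ≈⟨ +-congʳ (*-identityˡ _) ⟩
    g j + ∑ j (λ r → recip (j ∸ r) * g r)                        ∎

  recip⋆-α : ∀ n → recip⋆ α n ≈ δ n 0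
  recip⋆-α n = begin
    ∑ (suc n) (λ r → recip (n ∸ r) * α r)                 ≈⟨ ∑-reverse (suc n) (λ r → recip (n ∸ r) * α r) ⟩
    ∑ (suc n) (λ j → recip (n ∸ (n ∸ j)) * α (n ∸ j))     ≈⟨ ∑-cong (suc n) {λ j → recip (n ∸ (n ∸ j)) * α (n ∸ j)} (λ j j≤n → *-congʳ (reflexive (≡.cong recip (ℕ.m∸[m∸n]≡n (ℕ.≤-pred j≤n))))) ⟩
    ∑ (suc n) (λ j → recip j * α (n ∸ j))                 ≈⟨ recip-convolution n ⟩
    δ n 0                                                 ∎

  padded : ℕ → ℕ → Carrier
  padded zero    x       = α x
  padded (suc m) zero    = 0#
  padded (suc m) (suc x) = padded m x

  padded-+ : ∀ k d x → padded (k ℕ.+ d) (k ℕ.+ x) ≡ padded d x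
  padded-+ zero    d x = refl
  padded-+ (suc k) d x = padded-+ k d x

  padded-+ʳ : ∀ m x → padded m (m ℕ.+ x) ≡ α x
  padded-+ʳ zero    x = refl
  padded-+ʳ (suc m) x = padded-+ʳ m x

  padded-< : ∀ {m x} → x < m → padded m x ≡ 0#
  padded-< {suc m} {zero}  _         = refl
  padded-< {suc m} {suc x} (s≤s x<m) = padded-< x<m

  recip⋆-padded : ∀ d j → recip⋆ (padded d) j ≈ δ j d
  recip⋆-padded zero    j       = recip⋆-α j
  recip⋆-padded (suc d) zero    = ≈-trans (+-identityʳ _) (zeroʳ _)
  recip⋆-padded (suc d) (suc j) = ≈-trans (+-congʳ (zeroʳ _)) (≈-trans (+-identityˡ _) (recip⋆-padded d j))

  mixedMoment : ℕ → ℕ → Carrier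
  mixedMoment p u = β (u ℕ.+ p) + ∑ p (λ t → α (p ∸ t) * β (u ℕ.+ t))

  mixedMoment-suc : ∀ p u → mixedMoment (suc p) u ≈ α (suc p) * β u + mixedMoment p (suc u)
  mixedMoment-suc p u = begin
    β (u ℕ.+ suc p) + (α (suc p) * β (u ℕ.+ 0) + ∑ p (λ t → α (p ∸ t) * β (u ℕ.+ suc t)))
      ≈⟨ +-cong (reflexive (≡.cong β (ℕ.+-suc u p)))
                (+-cong (*-congˡ (reflexive (≡.cong β (ℕ.+-identityʳ u))))
                        (∑-cong p (λ t _ → *-congˡ (reflexive (≡.cong β (ℕ.+-suc u t)))))) ⟩
    β (suc u ℕ.+ p) + (α (suc p) * β u + ∑ p (λ t → α (p ∸ t) * β (suc u ℕ.+ t)))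
      ≈⟨ +-assoc _ _ _ ⟨
    β (suc u ℕ.+ p) + α (suc p) * β u + ∑ p (λ t → α (p ∸ t) * β (suc u ℕ.+ t))
      ≈⟨ +-congʳ (+-comm _ _) ⟩
    α (suc p) * β u + β (suc u ℕ.+ p) + ∑ p (λ t → α (p ∸ t) * β (suc u ℕ.+ t))
      ≈⟨ +-assoc _ _ _ ⟩
    α (suc p) * β u + mixedMoment p (suc u) ∎

  recip⋆-shift : ∀ p u → recip⋆ (λ r → α (suc p ℕ.+ r)) (suc u) ≈ recip⋆ (λ r → α (p ℕ.+ r)) (suc (suc u)) + β u * α p
  recip⋆-shift p u = begin
    Y                      ≈⟨ +-identityʳ _ ⟨
    Y + 0#                 ≈⟨ +-congˡ (-‿inverseˡ x) ⟨
    Y + (- x + x)          ≈⟨ +-assoc _ _ _ ⟨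
    (Y + - x) + x          ≈⟨ +-congʳ (+-comm _ _) ⟩
    (- x + Y) + x
      ≈⟨ +-congʳ (+-cong (≈-trans (-‿distribˡ-* _ _) (*-congˡ (reflexive (≡.cong α (≡.sym (ℕ.+-identityʳ p))))))
                          (recip⋆-cong (suc u) (λ r → reflexive (≡.cong α (≡.sym (ℕ.+-suc p r)))))) ⟩
    recip⋆ (λ r → α (p ℕ.+ r)) (suc (suc u)) + x ∎
    where
    x = β u * α p
    Y = recip⋆ (λ r → α (suc p ℕ.+ r)) (suc u)

  recip⋆-shifted-α : ∀ p u → recip⋆ (λ r → α (suc p ℕ.+ r)) (suc u) ≈ mixedMoment p u
  recip⋆-shifted-α zero u = begin
    recip⋆ (λ r → α (suc r)) (suc u)            ≈⟨ recip⋆-shift 0 u ⟩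
    recip⋆ α (suc (suc u)) + β u * α 0           ≈⟨ +-cong (recip⋆-α (suc (suc u))) (*-identityʳ _) ⟩
    0# + β u                                     ≈⟨ +-identityˡ _ ⟩
    β u                                          ≈⟨ +-identityʳ _ ⟨
    β u + 0#                                     ≡⟨ ≡.cong (λ k → β k + 0#) (ℕ.+-identityʳ u) ⟨
    mixedMoment 0 u                              ∎
  recip⋆-shifted-α (suc p) u = begin
    recip⋆ (λ r → α (suc (suc p) ℕ.+ r)) (suc u)                        ≈⟨ recip⋆-shift (suc p) u ⟩
    recip⋆ (λ r → α (suc p ℕ.+ r)) (suc (suc u)) + β u * α (suc p)      ≈⟨ +-cong (recip⋆-shifted-α p (suc u)) (*-comm _ _) ⟩
    mixedMoment p (suc u) + α (suc p) * β u                             ≈⟨ +-comm _ _ ⟩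
    α (suc p) * β u + mixedMoment p (suc u)                             ≈⟨ mixedMoment-suc p u ⟨
    mixedMoment (suc p) u                                               ∎

  a-⊖ : ∀ m x → a s (x ℤ.⊖ m) ≡ padded m x
  a-⊖ zero    x       = refl
  a-⊖ (suc m) zero    = refl
  a-⊖ (suc m) (suc x) = ≡.trans (≡.cong (a s) (ℤ.[1+m]⊖[1+n]≡m⊖n x m)) (a-⊖ m x)

  a-negative : ∀ m x → a s (ℤ.- ℤ.+ m ℤ.+ ℤ.+ x) ≡ padded m x
  a-negative zero    x = refl
  a-negative (suc m) x = a-⊖ (suc m) x

  D-negative≈det : ∀ m n → D (ℤ.- ℤ.+ m) n s ≈ det n (λ i j → padded m (i ℕ.+ j))
  D-negative≈det m n = Hankel-det≈det n _ _ λ i j →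
    reflexive (≡.trans (≡.cong (a s) (ℤ.+-assoc (ℤ.- ℤ.+ m) (ℤ.+ toℕ i) (ℤ.+ toℕ j))) (a-negative m (toℕ i ℕ.+ toℕ j)))

  D-negative-vanishes : ∀ m n → 0 < n → n ≤ m → D (ℤ.- ℤ.+ m) n s ≈ 0#
  D-negative-vanishes m (suc n) _ n<m = ≈-trans (D-negative≈det m (suc n))
    (det-zero-first-row n {λ i j → padded m (i ℕ.+ j)} λ j j≤n → reflexive (padded-< (ℕ.<-≤-trans j≤n n<m)))

  D-negative-reciprocity : ∀ m n → D (ℤ.- ℤ.+ m) (n ℕ.+ m ℕ.+ 1) s ≈ ε m * D (ℤ.+ m) n (E s)
  D-negative-reciprocity m n = begin
    D (ℤ.- ℤ.+ m) (n ℕ.+ m ℕ.+ 1) s                 ≡⟨ ≡.cong (λ N → D (ℤ.- ℤ.+ m) N s) size ⟩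
    D (ℤ.- ℤ.+ m) (suc m ℕ.+ n) s                   ≈⟨ D-negative≈det m (suc m ℕ.+ n) ⟩
    det (suc m ℕ.+ n) A                             ≈⟨ det-unitriangular (suc m ℕ.+ n) (λ j r → recip (j ∸ r)) (λ i → recip⋆-unitriangular (A i)) ⟨
    det (suc m ℕ.+ n) G                             ≈⟨ det-antidiagonal-block m n {G} G-top ⟩
    ε m * det n (λ p q → G (suc m ℕ.+ p) (suc m ℕ.+ q)) ≈⟨ *-congˡ (det-cong n λ p q _ _ → G-bottom p q) ⟩
    ε m * det n (λ p q → mixedMoment p (m ℕ.+ q))   ≈⟨ *-congˡ (det-transpose n (λ p q → mixedMoment p (m ℕ.+ q))) ⟨
    ε m * det n (λ p q → mixedMoment q (m ℕ.+ p))   ≈⟨ *-congˡ (det-unitriangular n (λ q t → α (q ∸ t)) (λ _ _ → ≈-refl)) ⟩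
    ε m * det n (λ p q → β (m ℕ.+ p ℕ.+ q))         ≈⟨ *-congˡ (Hankel-det≈det n _ _ (λ _ _ → ≈-refl)) ⟨
    ε m * D (ℤ.+ m) n (E s)                         ∎
    where
    size : n ℕ.+ m ℕ.+ 1 ≡ suc m ℕ.+ n
    size = ≡.trans (ℕ.+-comm (n ℕ.+ m) 1) (≡.cong suc (ℕ.+-comm n m))
    A G : Matrix
    A i j = padded m (i ℕ.+ j)
    G i j = recip⋆ (A i) j
    G-top : ∀ i j → i ≤ m → G i j ≈ δ (i ℕ.+ j) m
    G-top i j i≤m = begin
      recip⋆ (λ r → padded m (i ℕ.+ r)) j            ≡⟨ ≡.cong (λ k → recip⋆ (λ r → padded k (i ℕ.+ r)) j) i+d≡m ⟨
      recip⋆ (λ r → padded (i ℕ.+ d) (i ℕ.+ r)) j    ≈⟨ recip⋆-cong j (λ r → reflexive (padded-+ i d r)) ⟩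
      recip⋆ (padded d) j                            ≈⟨ recip⋆-padded d j ⟩
      δ j d                                          ≡⟨ δ-+ i j d ⟨
      δ (i ℕ.+ j) (i ℕ.+ d)                          ≡⟨ ≡.cong (δ (i ℕ.+ j)) i+d≡m ⟩
      δ (i ℕ.+ j) m                                  ∎
      where
      d = m ∸ i
      i+d≡m : i ℕ.+ d ≡ m
      i+d≡m = ℕ.m+[n∸m]≡n i≤m
    G-bottom : ∀ p q → G (suc m ℕ.+ p) (suc m ℕ.+ q) ≈ mixedMoment p (m ℕ.+ q)
    G-bottom p q = ≈-trans (recip⋆-cong (suc m ℕ.+ q) (λ r → reflexive (≡.trans (≡.cong (padded m) (shift r)) (padded-+ʳ m (suc (p ℕ.+ r))))))
                           (recip⋆-shifted-α p (m ℕ.+ q))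
      where
      shift : ∀ r → suc m ℕ.+ p ℕ.+ r ≡ m ℕ.+ suc (p ℕ.+ r)
      shift r = ≡.trans (≡.cong suc (ℕ.+-assoc m p r)) (≡.sym (ℕ.+-suc m (p ℕ.+ r)))

open import Data.Nat using (_+_)
open import Data.Integer using (+_; -_)

theorem1 : ∀ {c ℓ} (R : CommutativeRing c ℓ) (s : ℕ → CommutativeRing.Carrier R) (m : ℕ) →
    (CommutativeRing._≈_ R (Hankel.D R (- (+ m)) 0 s) (CommutativeRing.1# R))
    × (∀ n → 0 < n → n ≤ m → CommutativeRing._≈_ R (Hankel.D R (- (+ m)) n s) (CommutativeRing.0# R))
    × (∀ n → CommutativeRing._≈_ R (Hankel.D R (- (+ m)) (n + m + 1) s)
                                   (CommutativeRing._*_ R (Hankel.ε R m) (Hankel.D R (+ m) n (Hankel.E R s))))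
theorem1 R s m = CommutativeRing.refl R , D-negative-vanishes m , D-negative-reciprocity m
  where open NegativeHankel R s
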